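{- Let $G$ be a finite simple undirected graph with a vertex of degree at least three. Then there exist an infinite $G$-word $w$ and a map $\varphi$ from the vertices of $G$ to a $4$-letter alphabet such that $\varphi(w)$ is square-free. Moreover, for the claw $K_{1,3}$ there is no infinite $K_{1,3}$-word $w$ and map $\varphi\colon\{0,1,2,3\}\to\{0,1,2\}$ with $\varphi(w)$ square-free.
   Context: For a graph $G$, a finite or infinite word over its vertex set is a $G$-word if each consecutive pair of letters is an edge of $G$. A word is square-free if it has no factor $uu$ with $u$ nonempty. Maps on letters are extended letterwise to words. $K_{1,3}$ is the graph on $\{0,1,2,3\}$ with edges $01,02,03$. -}

module Defs where

open import Data.Nat using (ℕ; zero; suc; _+_; _<_)
open import Data.Fin using (Fin)
open import Data.Product using (Σ; _×_; ∃; _,_)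
open import Relation.Binary.PropositionalEquality using (_≡_)
open import Relation.Nullary using (¬_)

record SimpleGraph (n : ℕ) : Set₁ where
  field
    Adj    : Fin n → Fin n → Set
    sym    : ∀ {x y} → Adj x y → Adj y x
    irrefl : ∀ {x} → ¬ Adj x x

open SimpleGraph public

HasDegree≥3 : ∀ {n} → SimpleGraph n → Fin n → Set
HasDegree≥3 G v = Σ (Fin _) λ a → Σ (Fin _) λ b → Σ (Fin _) λ c →
  Adj G v a × Adj G v b × Adj G v c ×
  ¬ a ≡ b × ¬ a ≡ c × ¬ b ≡ c

InfWord : Set → Set
InfWord A = ℕ → A

IsGWord : ∀ {n} → SimpleGraph n → InfWord (Fin n) → Set
IsGWord G w = ∀ i → Adj G (w i) (w (suc i))

HasSquareAt : ∀ {A : Set} → InfWord A → ℕ → ℕ → Set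
HasSquareAt w i p = ∀ k → k < p → w (i + k) ≡ w (i + p + k)

SquareFree : ∀ {A : Set} → InfWord A → Set
SquareFree w = ∀ i p → 0 < p → ¬ HasSquareAt w i p

mapWord : ∀ {A B : Set} → (A → B) → InfWord A → InfWord B
mapWord φ w i = φ (w i)

data ClawAdj : Fin 4 → Fin 4 → Set where
  c-out : ∀ {j} → ¬ j ≡ Fin.zero → ClawAdj Fin.zero j
  c-in  : ∀ {j} → ¬ j ≡ Fin.zero → ClawAdj j Fin.zero

K13 : SimpleGraph 4
K13 = record { Adj = ClawAdj ; sym = s ; irrefl = ir }
  where
  s : ∀ {x y} → ClawAdj x y → ClawAdj y x
  s (c-out p) = c-in p
  s (c-in p)  = c-out p
  ir : ∀ {x} → ¬ ClawAdj x x
  ir (c-out p) = p _≡_.refl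
  ir (c-in p)  = p _≡_.refl

-- The Thue–Morse word t is overlap-free: an overlap of odd period is impossible because t
-- flips after every even position, and one of even period 2q halves to one of period q.
-- Hence the word of differences t(n+1) − t(n) ∈ {−1, 0, 1} is square-free, and separating
-- its letters by a fourth letter keeps it square-free while making it a walk on the claw:
-- centre, leaf, centre, ...  A vertex of degree at least three carries a copy of the claw,
-- so this walk transfers to G.  Conversely, every other letter of a walk on the claw is the
-- centre; avoiding squares of period one and two forces the images of the leaves to
-- alternate between the two remaining letters, which produces a square of period four.
module Submission where

open import Defs hiding (sym)
open import Data.Fin using (Fin; zero; suc; _≟_)
open import Data.Fin.Patterns using (0F; 1F; 2F)
open import Data.Fin.Properties using (suc-injective; any?; punchOut-injective)
open import Data.List using (_∷_; [])
open import Data.Nat using (ℕ; zero; suc; _+_; _≤_; _<_; z≤n; s≤s; z<s; ⌊_/2⌋; parity)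
open import Data.Nat.Induction using (<-rec; <-wellFounded)
open import Data.Nat.Properties
  using (⌊n/2⌋<n; +-identityʳ; +-suc; +-assoc; <⇒≤; ≤-refl; ≤-<-trans; <-irrefl;
         m<m+n; +-mono-≤; +-monoˡ-≤)
open import Data.Nat.Tactic.RingSolver using (solve)
open import Data.Parity.Base as ℙ using (Parity; 0ℙ; 1ℙ; _⁻¹)
open import Data.Parity.Properties as ℙₚ
  using (+-homo-+; p+p≡0ℙ; p≢p⁻¹; suc-homo-⁻¹; ⁻¹-selfInverse; ⁻¹-involutive; +-cancelˡ-≡)
open import Data.Product using (Σ; ∃; ∃₂; _×_; _,_; proj₁)
open import Data.Sum using (_⊎_; inj₁; inj₂)
open import Function using (_∘_)
open import Function.Definitions using (Injective)
open import Induction.WellFounded using (module FixPoint)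
open import Relation.Binary.Definitions using (DecidableEquality)
open import Relation.Binary.PropositionalEquality
  using (_≡_; _≢_; _≗_; refl; sym; trans; cong; cong₂; subst; subst₂; ≢-sym; module ≡-Reasoning)
open import Relation.Nullary using (¬_; Dec; yes; no; contradiction)

open ≡-Reasoning

private
  variable
    A : Set

OverlapAt : InfWord A → ℕ → ℕ → Set
OverlapAt w i p = ∀ k → k ≤ p → w (i + k) ≡ w (i + p + k)

OverlapFree : InfWord A → Set
OverlapFree w = ∀ i p → 0 < p → ¬ OverlapAt w i p

squareFree-resp-≗ : {x y : InfWord A} → x ≗ y → SquareFree x → SquareFree y
squareFree-resp-≗ x≗y sf i p p>0 sq =
  sf i p p>0 λ k k<p → trans (x≗y (i + k)) (trans (sq k k<p) (sym (x≗y (i + p + k))))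

mapWord-squareFree : ∀ {B : Set} {f : A → B} {w : InfWord A} →
                     Injective _≡_ _≡_ f → SquareFree w → SquareFree (mapWord f w)
mapWord-squareFree f-injective sf i p p>0 sq = sf i p p>0 λ k k<p → f-injective (sq k k<p)

mapWord-isGWord : ∀ {m n} {H : SimpleGraph m} {G : SimpleGraph n} {e : Fin m → Fin n} {w} →
                  (∀ {x y} → Adj H x y → Adj G (e x) (e y)) → IsGWord H w → IsGWord G (mapWord e w)
mapWord-isGWord e-hom w-walk i = e-hom (w-walk i)

even⇒double : ∀ n → parity n ≡ 0ℙ → ∃ λ h → n ≡ h + h
even⇒double zero          _    = 0 , refl
even⇒double (suc zero)    ()
even⇒double (suc (suc n)) even with even⇒double n even
... | h , n≡h+h = suc h , cong suc (trans (cong suc n≡h+h) (sym (+-suc h h)))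

odd-within-one : ∀ i → ∃₂ λ m e → e ≤ 1 × i + e ≡ suc (m + m)
odd-within-one zero          = 0 , 1 , s≤s z≤n , refl
odd-within-one (suc zero)    = 0 , 0 , z≤n , refl
odd-within-one (suc (suc i)) with odd-within-one i
... | m , e , e≤1 , i+e≡ = suc m , e , e≤1 , cong (λ n → suc (suc n)) (trans i+e≡ (sym (+-suc m m)))

parity-+-double : ∀ n j → parity (n + (j + j)) ≡ parity n
parity-+-double n j = begin
  parity (n + (j + j))               ≡⟨ +-homo-+ n (j + j) ⟩
  parity n ℙ.+ parity (j + j)        ≡⟨ cong (parity n ℙ.+_) (+-homo-+ j j) ⟩
  parity n ℙ.+ (parity j ℙ.+ parity j) ≡⟨ cong (parity n ℙ.+_) (p+p≡0ℙ (parity j)) ⟩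
  parity n ℙ.+ 0ℙ                    ≡⟨ ℙₚ.+-identityʳ (parity n) ⟩
  parity n                           ∎

⌊n+[j+j]/2⌋≡⌊n/2⌋+j : ∀ n j → ⌊ n + (j + j) /2⌋ ≡ ⌊ n /2⌋ + j
⌊n+[j+j]/2⌋≡⌊n/2⌋+j n zero    = trans (cong ⌊_/2⌋ (+-identityʳ n)) (sym (+-identityʳ ⌊ n /2⌋))
⌊n+[j+j]/2⌋≡⌊n/2⌋+j n (suc j) = begin
  ⌊ n + (suc j + suc j) /2⌋          ≡⟨ cong ⌊_/2⌋ (solve (n ∷ j ∷ [])) ⟩
  ⌊ 2 + (n + (j + j)) /2⌋            ≡⟨ cong suc (⌊n+[j+j]/2⌋≡⌊n/2⌋+j n j) ⟩
  suc (⌊ n /2⌋ + j)                  ≡⟨ sym (+-suc ⌊ n /2⌋ j) ⟩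
  ⌊ n /2⌋ + suc j                    ∎

⁻¹-distribˡ-+ : ∀ p q → (p ℙ.+ q) ⁻¹ ≡ p ⁻¹ ℙ.+ q
⁻¹-distribˡ-+ 0ℙ q = refl
⁻¹-distribˡ-+ 1ℙ q = ⁻¹-involutive q

parity-suc : ∀ n → parity (suc n) ≡ parity n ⁻¹
parity-suc n = sym (⁻¹-selfInverse (suc-homo-⁻¹ n))

-- The Thue–Morse word

-- thueMorse n is the parity of the number of ones in the binary expansion of n.
thueMorse : InfWord Parity
thueMorse = <-rec _ step
  module ThueMorse where
  step : ∀ n → (∀ {m} → m < n → Parity) → Parity
  step zero    _   = 0ℙ
  step (suc n) rec = parity (suc n) ℙ.+ rec (⌊n/2⌋<n n)

thueMorse-unfold : ∀ n → thueMorse n ≡ parity n ℙ.+ thueMorse ⌊ n /2⌋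
thueMorse-unfold zero    = refl
thueMorse-unfold (suc n) = FixPoint.unfold-wfRec <-wellFounded _ ThueMorse.step step-ext {suc n}
  where
  step-ext : ∀ m {r r′ : ∀ {k} → k < m → Parity} → (∀ {k} (k<m : k < m) → r k<m ≡ r′ k<m) →
             ThueMorse.step m r ≡ ThueMorse.step m r′
  step-ext zero    _    = refl
  step-ext (suc m) r≡r′ = cong (parity (suc m) ℙ.+_) (r≡r′ (⌊n/2⌋<n m))

thueMorse-+-double : ∀ n j → thueMorse (n + (j + j)) ≡ parity n ℙ.+ thueMorse (⌊ n /2⌋ + j)
thueMorse-+-double n j = begin
  thueMorse (n + (j + j))                                ≡⟨ thueMorse-unfold (n + (j + j)) ⟩
  parity (n + (j + j)) ℙ.+ thueMorse ⌊ n + (j + j) /2⌋  ≡⟨ cong₂ ℙ._+_ (parity-+-double n j)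
                                                            (cong thueMorse (⌊n+[j+j]/2⌋≡⌊n/2⌋+j n j)) ⟩
  parity n ℙ.+ thueMorse (⌊ n /2⌋ + j)                  ∎

thueMorse-flipsAtEven : ∀ y → parity y ≡ 0ℙ → thueMorse (suc y) ≡ thueMorse y ⁻¹
thueMorse-flipsAtEven y even with even⇒double y even
... | h , refl = trans (thueMorse-+-double 1 h) (cong _⁻¹ (sym (thueMorse-+-double 0 h)))

-- An overlap of odd period p would make x alternate on [i, i + p], contradicting x i ≡ x (i + p).
flipsAtEven⇒noOddOverlap : {x : InfWord Parity} → (∀ y → parity y ≡ 0ℙ → x (suc y) ≡ x y ⁻¹) →
                           ∀ i p → parity p ≡ 1ℙ → ¬ OverlapAt x i p
flipsAtEven⇒noOddOverlap {x} flips i p odd overlapAt = p≢p⁻¹ (x (i + 0)) (begin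
  x (i + 0)                  ≡⟨ overlapAt 0 z≤n ⟩
  x (i + p + 0)              ≡⟨ cong x (+-identityʳ (i + p)) ⟩
  x (i + p)                  ≡⟨ alternates p ≤-refl ⟩
  parity p ℙ.+ x (i + 0)     ≡⟨ cong (ℙ._+ x (i + 0)) odd ⟩
  x (i + 0) ⁻¹               ∎)
  where
  flip : ∀ k → k < p → x (i + suc k) ≡ x (i + k) ⁻¹
  flip k k<p with parity (i + k) in i+k-parity
  ... | 0ℙ = trans (cong x (+-suc i k)) (flips (i + k) i+k-parity)
  ... | 1ℙ = begin
    x (i + suc k)            ≡⟨ overlapAt (suc k) k<p ⟩
    x (i + p + suc k)        ≡⟨ cong x (+-suc (i + p) k) ⟩
    x (suc (i + p + k))      ≡⟨ flips (i + p + k) i+p+k-even ⟩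
    x (i + p + k) ⁻¹         ≡⟨ cong _⁻¹ (sym (overlapAt k (<⇒≤ k<p))) ⟩
    x (i + k) ⁻¹             ∎
    where
    i+p+k≡i+k+p : i + p + k ≡ i + k + p
    i+p+k≡i+k+p = solve (i ∷ p ∷ k ∷ [])
    i+p+k-even : parity (i + p + k) ≡ 0ℙ
    i+p+k-even = begin
      parity (i + p + k)             ≡⟨ cong parity i+p+k≡i+k+p ⟩
      parity (i + k + p)             ≡⟨ +-homo-+ (i + k) p ⟩
      parity (i + k) ℙ.+ parity p    ≡⟨ cong₂ ℙ._+_ i+k-parity odd ⟩
      0ℙ                             ∎
  alternates : ∀ k → k ≤ p → x (i + k) ≡ parity k ℙ.+ x (i + 0)
  alternates zero    _   = refl
  alternates (suc k) k<p = begin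
    x (i + suc k)                    ≡⟨ flip k k<p ⟩
    x (i + k) ⁻¹                     ≡⟨ cong _⁻¹ (alternates k (<⇒≤ k<p)) ⟩
    (parity k ℙ.+ x (i + 0)) ⁻¹      ≡⟨ ⁻¹-distribˡ-+ (parity k) (x (i + 0)) ⟩
    parity k ⁻¹ ℙ.+ x (i + 0)        ≡⟨ cong (ℙ._+ x (i + 0)) (sym (parity-suc k)) ⟩
    parity (suc k) ℙ.+ x (i + 0)     ∎

thueMorse-halveOverlap : ∀ i q → OverlapAt thueMorse i (q + q) → OverlapAt thueMorse ⌊ i /2⌋ q
thueMorse-halveOverlap i q overlapAt j j≤q = +-cancelˡ-≡ (parity i) _ _ (begin
  parity i ℙ.+ thueMorse (⌊ i /2⌋ + j)          ≡⟨ sym (thueMorse-+-double i j) ⟩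
  thueMorse (i + (j + j))                       ≡⟨ overlapAt (j + j) (+-mono-≤ j≤q j≤q) ⟩
  thueMorse (i + (q + q) + (j + j))             ≡⟨ cong thueMorse regroup ⟩
  thueMorse (i + ((q + j) + (q + j)))           ≡⟨ thueMorse-+-double i (q + j) ⟩
  parity i ℙ.+ thueMorse (⌊ i /2⌋ + (q + j))    ≡⟨ cong (λ n → parity i ℙ.+ thueMorse n)
                                                         (sym (+-assoc ⌊ i /2⌋ q j)) ⟩
  parity i ℙ.+ thueMorse (⌊ i /2⌋ + q + j)      ∎)
  where
  regroup : i + (q + q) + (j + j) ≡ i + ((q + j) + (q + j))
  regroup = solve (i ∷ q ∷ j ∷ [])

thueMorse-overlapFree : OverlapFree thueMorse
thueMorse-overlapFree i p = <-rec (λ p → ∀ i → 0 < p → ¬ OverlapAt thueMorse i p) noOverlap p i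
  where
  noOverlap : ∀ p → (∀ {q} → q < p → ∀ i → 0 < q → ¬ OverlapAt thueMorse i q) →
              ∀ i → 0 < p → ¬ OverlapAt thueMorse i p
  noOverlap p rec i p>0 overlapAt with parity p in p-parity
  ... | 1ℙ = flipsAtEven⇒noOddOverlap thueMorse-flipsAtEven i p p-parity overlapAt
  ... | 0ℙ with even⇒double p p-parity
  ...   | zero  , refl = <-irrefl refl p>0
  ...   | suc q , refl =
    rec (m<m+n (suc q) z<s) ⌊ i /2⌋ z<s (thueMorse-halveOverlap i (suc q) overlapAt)

-- The ternary word of differences

-- difference a b encodes b − a ∈ {−1, 0, 1} as 0F, 1F, 2F.
difference : Parity → Parity → Fin 3
difference 1ℙ 0ℙ = 0F
difference 0ℙ 0ℙ = 1F
difference 1ℙ 1ℙ = 1F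
difference 0ℙ 1ℙ = 2F

differences : InfWord Parity → InfWord (Fin 3)
differences x n = difference (x n) (x (suc n))

difference-injectiveʳ : ∀ {a x y} → difference a x ≡ difference a y → x ≡ y
difference-injectiveʳ {0ℙ} {0ℙ} {0ℙ} _ = refl
difference-injectiveʳ {0ℙ} {1ℙ} {1ℙ} _ = refl
difference-injectiveʳ {1ℙ} {0ℙ} {0ℙ} _ = refl
difference-injectiveʳ {1ℙ} {1ℙ} {1ℙ} _ = refl
difference-injectiveʳ {0ℙ} {0ℙ} {1ℙ} ()
difference-injectiveʳ {0ℙ} {1ℙ} {0ℙ} ()
difference-injectiveʳ {1ℙ} {0ℙ} {1ℙ} ()
difference-injectiveʳ {1ℙ} {1ℙ} {0ℙ} ()

-- Two steps starting from different letters can only have the same difference 0.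
difference-≢ : ∀ {a b x y} → a ≢ b → difference a x ≡ difference b y → x ≡ a × y ≡ b
difference-≢ {0ℙ} {0ℙ}           a≢b _  = contradiction refl a≢b
difference-≢ {1ℙ} {1ℙ}           a≢b _  = contradiction refl a≢b
difference-≢ {0ℙ} {1ℙ} {0ℙ} {1ℙ} _   _  = refl , refl
difference-≢ {1ℙ} {0ℙ} {1ℙ} {0ℙ} _   _  = refl , refl
difference-≢ {0ℙ} {1ℙ} {0ℙ} {0ℙ} _   ()
difference-≢ {0ℙ} {1ℙ} {1ℙ} {0ℙ} _   ()
difference-≢ {0ℙ} {1ℙ} {1ℙ} {1ℙ} _   ()
difference-≢ {1ℙ} {0ℙ} {0ℙ} {0ℙ} _   ()
difference-≢ {1ℙ} {0ℙ} {0ℙ} {1ℙ} _   ()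
difference-≢ {1ℙ} {0ℙ} {1ℙ} {1ℙ} _   ()

module _ {f g : InfWord Parity} {q : ℕ} (same : ∀ k → k < q → differences f k ≡ differences g k) where

  sameDifferences-sameStart⇒agree : f 0 ≡ g 0 → ∀ k → k ≤ q → f k ≡ g k
  sameDifferences-sameStart⇒agree f0≡g0 zero    _   = f0≡g0
  sameDifferences-sameStart⇒agree f0≡g0 (suc k) k<q = difference-injectiveʳ
    (subst (λ a → difference a (f (suc k)) ≡ differences g k)
           (sameDifferences-sameStart⇒agree f0≡g0 k (<⇒≤ k<q)) (same k k<q))

  sameDifferences-constant : f 0 ≢ g 0 → ∀ k → k ≤ q → f k ≡ f 0 × g k ≡ g 0
  sameDifferences-constant f0≢g0 zero    _   = refl , refl
  sameDifferences-constant f0≢g0 (suc k) k<q with sameDifferences-constant f0≢g0 k (<⇒≤ k<q)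
  ... | fk≡f0 , gk≡g0 = difference-≢ f0≢g0
    (subst₂ (λ a b → difference a (f (suc k)) ≡ difference b (g (suc k))) fk≡f0 gk≡g0 (same k k<q))

  sameDifferences-consecutive⇒agree : f q ≡ g 0 → ∀ k → k ≤ q → f k ≡ g k
  sameDifferences-consecutive⇒agree fq≡g0 with f 0 ℙₚ.≟ g 0
  ... | yes f0≡g0 = sameDifferences-sameStart⇒agree f0≡g0
  ... | no  f0≢g0 =
    contradiction (trans (sym (proj₁ (sameDifferences-constant f0≢g0 q ≤-refl))) fq≡g0) f0≢g0

square⇒sameDifferences : ∀ {x : InfWord Parity} {m q} → HasSquareAt (differences x) m q →
                         ∀ k → k < q →
                         differences (λ k → x (m + k)) k ≡ differences (λ k → x (m + q + k)) k
square⇒sameDifferences {x} {m} {q} square k k<q = begin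
  difference (x (m + k)) (x (m + suc k))          ≡⟨ cong (difference (x (m + k)) ∘ x) (+-suc m k) ⟩
  differences x (m + k)                           ≡⟨ square k k<q ⟩
  differences x (m + q + k)                       ≡⟨ cong (difference (x (m + q + k)) ∘ x)
                                                          (sym (+-suc (m + q) k)) ⟩
  difference (x (m + q + k)) (x (m + q + suc k))  ∎

differences-squareFree : {x : InfWord Parity} → OverlapFree x → SquareFree (differences x)
differences-squareFree {x} overlapFree m q q>0 square = overlapFree m q q>0
  (sameDifferences-consecutive⇒agree (square⇒sameDifferences {x} {m} {q} square)
                                     (cong x (sym (+-identityʳ (m + q)))))

-- Interleaving with a separator

interleave : A → InfWord A → InfWord A
interleave s x zero                = s
interleave s x (suc zero)          = x 0
interleave s x (suc (suc n))       = interleave s (x ∘ suc) n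

interleave-isGWord : ∀ {n} (G : SimpleGraph n) {s x} → (∀ h → Adj G s (x h)) → IsGWord G (interleave s x)
interleave-isGWord G s-adj zero          = s-adj 0
interleave-isGWord G s-adj (suc zero)    = SimpleGraph.sym G (s-adj 0)
interleave-isGWord G s-adj (suc (suc i)) = interleave-isGWord G (s-adj ∘ suc) i

interleave-even : ∀ {s : A} {x} n → parity n ≡ 0ℙ → interleave s x n ≡ s
interleave-even zero          _    = refl
interleave-even (suc zero)    ()
interleave-even (suc (suc n)) even = interleave-even n even

interleave-odd≢ : ∀ {s : A} {x} → (∀ h → x h ≢ s) → ∀ n → parity n ≡ 1ℙ → interleave s x n ≢ s
interleave-odd≢ x≢s zero          ()
interleave-odd≢ x≢s (suc zero)    _   = x≢s 0
interleave-odd≢ x≢s (suc (suc n)) odd = interleave-odd≢ (x≢s ∘ suc) n odd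

interleave-odd : ∀ {s : A} {x} h → interleave s x (suc (h + h)) ≡ x h
interleave-odd zero    = refl
interleave-odd {s = s} {x} (suc h) = trans (cong (interleave s (x ∘ suc)) (+-suc h h)) (interleave-odd h)

interleave-≡⇒parity≡ : ∀ {s : A} {x} → (∀ h → x h ≢ s) →
                       ∀ m n → interleave s x m ≡ interleave s x n → parity m ≡ parity n
interleave-≡⇒parity≡ x≢s m n eq with parity m in m-parity | parity n in n-parity
... | 0ℙ | 0ℙ = refl
... | 1ℙ | 1ℙ = refl
... | 0ℙ | 1ℙ = contradiction (trans (sym eq) (interleave-even m m-parity)) (interleave-odd≢ x≢s n n-parity)
... | 1ℙ | 0ℙ = contradiction (trans eq (interleave-even n n-parity)) (interleave-odd≢ x≢s m m-parity)

interleave-noOddSquare : ∀ {s : A} {x} → (∀ h → x h ≢ s) →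
                         ∀ i p → parity p ≡ 1ℙ → 0 < p → ¬ HasSquareAt (interleave s x) i p
interleave-noOddSquare x≢s i p odd p>0 square = p≢p⁻¹ (parity (i + 0)) (begin
  parity (i + 0)                   ≡⟨ interleave-≡⇒parity≡ x≢s (i + 0) (i + p + 0) (square 0 p>0) ⟩
  parity (i + p + 0)               ≡⟨ cong parity i+p+0≡i+0+p ⟩
  parity (i + 0 + p)               ≡⟨ +-homo-+ (i + 0) p ⟩
  parity (i + 0) ℙ.+ parity p      ≡⟨ cong (parity (i + 0) ℙ.+_) odd ⟩
  parity (i + 0) ℙ.+ 1ℙ            ≡⟨ ℙₚ.+-comm (parity (i + 0)) 1ℙ ⟩
  parity (i + 0) ⁻¹                ∎)
  where
  i+p+0≡i+0+p : i + p + 0 ≡ i + 0 + p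
  i+p+0≡i+0+p = solve (i ∷ p ∷ [])

-- The odd positions of a square of even period 2q form a square of period q in x.
interleave-halveSquare : ∀ {s : A} {x} i q → HasSquareAt (interleave s x) i (q + q) →
                         ∃ λ m → HasSquareAt x m q
interleave-halveSquare {s = s} {x} i q square with odd-within-one i
... | m , e , e≤1 , i+e≡ = m , λ j j<q → begin
  x (m + j)                                     ≡⟨ sym (atOdd j) ⟩
  interleave s x (i + (e + (j + j)))            ≡⟨ square (e + (j + j)) (offset<period j j<q) ⟩
  interleave s x (i + (q + q) + (e + (j + j)))  ≡⟨ cong (interleave s x) (regroup j) ⟩
  interleave s x (i + (e + ((q + j) + (q + j)))) ≡⟨ atOdd (q + j) ⟩
  x (m + (q + j))                               ≡⟨ cong x (sym (+-assoc m q j)) ⟩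
  x (m + q + j)                                 ∎
  where
  pairUp : ∀ r → suc (m + m) + (r + r) ≡ suc ((m + r) + (m + r))
  pairUp r = solve (m ∷ r ∷ [])
  atOdd : ∀ r → interleave s x (i + (e + (r + r))) ≡ x (m + r)
  atOdd r = begin
    interleave s x (i + (e + (r + r)))          ≡⟨ cong (interleave s x) (sym (+-assoc i e (r + r))) ⟩
    interleave s x (i + e + (r + r))            ≡⟨ cong (λ n → interleave s x (n + (r + r))) i+e≡ ⟩
    interleave s x (suc (m + m) + (r + r))      ≡⟨ cong (interleave s x) (pairUp r) ⟩
    interleave s x (suc ((m + r) + (m + r)))    ≡⟨ interleave-odd (m + r) ⟩
    x (m + r)                                   ∎
  regroup : ∀ j → i + (q + q) + (e + (j + j)) ≡ i + (e + ((q + j) + (q + j)))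
  regroup j = solve (i ∷ q ∷ e ∷ j ∷ [])
  offset<period : ∀ j → j < q → e + (j + j) < q + q
  offset<period j j<q = ≤-<-trans (+-monoˡ-≤ (j + j) e≤1)
                                  (subst (_≤ q + q) (cong suc (+-suc j j)) (+-mono-≤ j<q j<q))

interleave-squareFree : ∀ {s : A} {x} → (∀ h → x h ≢ s) → SquareFree x → SquareFree (interleave s x)
interleave-squareFree x≢s squareFree i p p>0 square with parity p in p-parity
... | 1ℙ = interleave-noOddSquare x≢s i p p-parity p>0 square
... | 0ℙ with even⇒double p p-parity
...   | zero  , refl = <-irrefl refl p>0
...   | suc q , refl with interleave-halveSquare i (suc q) square
...     | m , square′ = squareFree m (suc q) z<s square′

-- Walks on the claw

clawWord : InfWord (Fin 4)
clawWord = interleave 0F (mapWord suc (differences thueMorse))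

clawWord-isGWord : IsGWord K13 clawWord
clawWord-isGWord = interleave-isGWord K13 (λ _ → c-out λ ())

clawWord-squareFree : SquareFree clawWord
clawWord-squareFree = interleave-squareFree (λ _ ())
  (mapWord-squareFree {w = differences thueMorse} suc-injective
                      (differences-squareFree {thueMorse} thueMorse-overlapFree))

clawAdj-centre : ∀ {x y} → ClawAdj x y → x ≡ 0F ⊎ y ≡ 0F
clawAdj-centre (c-out _) = inj₁ refl
clawAdj-centre (c-in _)  = inj₂ refl

clawWalk-centre : ∀ {w} → IsGWord K13 w → ∀ {i} → w i ≡ 0F → w (suc (suc i)) ≡ 0F
clawWalk-centre walk {i} wi≡0 with clawAdj-centre (walk (suc i))
... | inj₂ centre = centre
... | inj₁ w1+i≡0 = contradiction (subst₂ ClawAdj wi≡0 w1+i≡0 (walk i)) (irrefl K13)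

-- Removing c leaves a two-letter alphabet.
fin3-alternate : ∀ {c x y z : Fin 3} → x ≢ c → y ≢ c → z ≢ c → x ≢ y → y ≢ z → x ≡ z
fin3-alternate x≢c y≢c z≢c x≢y y≢z = punchOut-injective c≢x c≢z
  (fin2-alternate (x≢y ∘ punchOut-injective c≢x c≢y) (y≢z ∘ punchOut-injective c≢y c≢z))
  where
  c≢x = ≢-sym x≢c
  c≢y = ≢-sym y≢c
  c≢z = ≢-sym z≢c
  fin2-alternate : ∀ {a b d : Fin 2} → a ≢ b → b ≢ d → a ≡ d
  fin2-alternate {0F} {_}  {0F} _   _   = refl
  fin2-alternate {1F} {_}  {1F} _   _   = refl
  fin2-alternate {0F} {0F} {1F} a≢b _   = contradiction refl a≢b
  fin2-alternate {0F} {1F} {1F} _   b≢d = contradiction refl b≢d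
  fin2-alternate {1F} {1F} {0F} a≢b _   = contradiction refl a≢b
  fin2-alternate {1F} {0F} {0F} _   b≢d = contradiction refl b≢d

-- Squares of period one and two force the odd letters to alternate between the two letters
-- other than c, which yields a square of period four.
everyOtherLetter⇒¬squareFree : ∀ {z : InfWord (Fin 3)} {c} →
                               z 0 ≡ c → z 2 ≡ c → z 4 ≡ c → z 6 ≡ c → ¬ SquareFree z
everyOtherLetter⇒¬squareFree {z} {c} c₀ c₂ c₄ c₆ squareFree =
  squareFree 0 4 z<s (square₄ (trans c₀ (sym c₄)) z₁≡z₅ (trans c₂ (sym c₆)) z₃≡z₇)
  where
  square₁ : ∀ {i} → z (i + 0) ≡ z (i + 1 + 0) → HasSquareAt z i 1
  square₁ e₀ zero    _        = e₀
  square₁ e₀ (suc _) (s≤s ())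
  square₂ : ∀ {i} → z (i + 0) ≡ z (i + 2 + 0) → z (i + 1) ≡ z (i + 2 + 1) → HasSquareAt z i 2
  square₂ e₀ e₁ zero          _              = e₀
  square₂ e₀ e₁ (suc zero)    _              = e₁
  square₂ e₀ e₁ (suc (suc _)) (s≤s (s≤s ()))
  square₄ : z 0 ≡ z 4 → z 1 ≡ z 5 → z 2 ≡ z 6 → z 3 ≡ z 7 → HasSquareAt z 0 4
  square₄ e₀ e₁ e₂ e₃ zero                      _ = e₀
  square₄ e₀ e₁ e₂ e₃ (suc zero)                _ = e₁
  square₄ e₀ e₁ e₂ e₃ (suc (suc zero))          _ = e₂
  square₄ e₀ e₁ e₂ e₃ (suc (suc (suc zero)))    _ = e₃
  square₄ e₀ e₁ e₂ e₃ (suc (suc (suc (suc _)))) (s≤s (s≤s (s≤s (s≤s ()))))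

  z₁≢c : z 1 ≢ c
  z₁≢c e = squareFree 0 1 z<s (square₁ (trans c₀ (sym e)))
  z₃≢c : z 3 ≢ c
  z₃≢c e = squareFree 2 1 z<s (square₁ (trans c₂ (sym e)))
  z₅≢c : z 5 ≢ c
  z₅≢c e = squareFree 4 1 z<s (square₁ (trans c₄ (sym e)))
  z₇≢c : z 7 ≢ c
  z₇≢c e = squareFree 6 1 z<s (square₁ (trans c₆ (sym e)))
  z₁≢z₃ : z 1 ≢ z 3
  z₁≢z₃ e = squareFree 0 2 z<s (square₂ (trans c₀ (sym c₂)) e)
  z₃≢z₅ : z 3 ≢ z 5
  z₃≢z₅ e = squareFree 2 2 z<s (square₂ (trans c₂ (sym c₄)) e)
  z₅≢z₇ : z 5 ≢ z 7
  z₅≢z₇ e = squareFree 4 2 z<s (square₂ (trans c₄ (sym c₆)) e)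
  z₁≡z₅ : z 1 ≡ z 5
  z₁≡z₅ = fin3-alternate z₁≢c z₃≢c z₅≢c z₁≢z₃ z₃≢z₅
  z₃≡z₇ : z 3 ≡ z 7
  z₃≡z₇ = fin3-alternate z₃≢c z₅≢c z₇≢c z₃≢z₅ z₅≢z₇

clawWalk-noSquareFreeImage : ∀ {w} (φ : Fin 4 → Fin 3) → IsGWord K13 w → w 0 ≡ 0F →
                             ¬ SquareFree (mapWord φ w)
clawWalk-noSquareFreeImage {w} φ walk w₀≡0 =
  everyOtherLetter⇒¬squareFree {mapWord φ w}
    (cong φ w₀≡0) (cong φ w₂≡0) (cong φ w₄≡0) (cong φ w₆≡0)
  where
  w₂≡0 = clawWalk-centre walk w₀≡0
  w₄≡0 = clawWalk-centre walk w₂≡0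
  w₆≡0 = clawWalk-centre walk w₄≡0

claw-noSquareFreeTernaryImage : ¬ (Σ (InfWord (Fin 4)) λ w → Σ (Fin 4 → Fin 3) λ φ →
                                     IsGWord K13 w × SquareFree (mapWord φ w))
claw-noSquareFreeTernaryImage (w , φ , walk , squareFree) with clawAdj-centre (walk 0)
... | inj₁ w₀≡0 = clawWalk-noSquareFreeImage φ walk w₀≡0 squareFree
... | inj₂ w₁≡0 = clawWalk-noSquareFreeImage φ (walk ∘ suc) w₁≡0 (squareFree ∘ suc)

-- Embedding the claw

injective⇒leftInverse : ∀ {B : Set} {k} → DecidableEquality B →
                        (e : Fin (suc k) → B) → Injective _≡_ _≡_ e →
                        Σ (B → Fin (suc k)) λ φ → ∀ i → φ (e i) ≡ i
injective⇒leftInverse {B = B} {k} _≟ᴮ_ e e-injective = φ , φ∘e≡id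
  where
  preimage : ∀ {b} → Dec (∃ λ i → e i ≡ b) → Fin (suc k)
  preimage (yes (i , _)) = i
  preimage (no _)        = zero
  φ : B → Fin (suc k)
  φ b = preimage (any? λ i → e i ≟ᴮ b)
  φ∘e≡id : ∀ i → φ (e i) ≡ i
  φ∘e≡id i with any? (λ j → e j ≟ᴮ e i)
  ... | yes (j , ej≡ei) = e-injective ej≡ei
  ... | no  none        = contradiction (i , refl) none

clawEmbedding : ∀ {n} (G : SimpleGraph n) {v} → HasDegree≥3 G v →
                Σ (Fin 4 → Fin n) λ e →
                  Injective _≡_ _≡_ e × (∀ {x y} → ClawAdj x y → Adj G (e x) (e y))
clawEmbedding {n} G {v} (a , b , c , va , vb , vc , a≢b , a≢c , b≢c) = e , e-injective , e-hom
  where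
  leaf : Fin 3 → Fin n
  leaf 0F = a
  leaf 1F = b
  leaf 2F = c
  leaf-adj : ∀ j → Adj G v (leaf j)
  leaf-adj 0F = va
  leaf-adj 1F = vb
  leaf-adj 2F = vc
  leaf-injective : Injective _≡_ _≡_ leaf
  leaf-injective {0F} {0F} _ = refl
  leaf-injective {1F} {1F} _ = refl
  leaf-injective {2F} {2F} _ = refl
  leaf-injective {0F} {1F} a≡b = contradiction a≡b a≢b
  leaf-injective {0F} {2F} a≡c = contradiction a≡c a≢c
  leaf-injective {1F} {2F} b≡c = contradiction b≡c b≢c
  leaf-injective {1F} {0F} b≡a = contradiction (sym b≡a) a≢b
  leaf-injective {2F} {0F} c≡a = contradiction (sym c≡a) a≢c
  leaf-injective {2F} {1F} c≡b = contradiction (sym c≡b) b≢c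
  e : Fin 4 → Fin n
  e zero    = v
  e (suc j) = leaf j
  v≢leaf : ∀ j → v ≢ leaf j
  v≢leaf j v≡leaf = irrefl G (subst (Adj G v) (sym v≡leaf) (leaf-adj j))
  e-injective : Injective _≡_ _≡_ e
  e-injective {zero}  {zero}  _    = refl
  e-injective {zero}  {suc j} v≡   = contradiction v≡ (v≢leaf j)
  e-injective {suc i} {zero}  ≡v   = contradiction (sym ≡v) (v≢leaf i)
  e-injective {suc i} {suc j} eq   = cong suc (leaf-injective eq)
  centre-adj : ∀ {j} → j ≢ 0F → Adj G v (e j)
  centre-adj {zero}  j≢0 = contradiction refl j≢0
  centre-adj {suc j} _   = leaf-adj j
  e-hom : ∀ {x y} → ClawAdj x y → Adj G (e x) (e y)
  e-hom (c-out j≢0) = centre-adj j≢0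
  e-hom (c-in j≢0)  = SimpleGraph.sym G (centre-adj j≢0)

degree≥3⇒squareFreeImage : ∀ n (G : SimpleGraph n) v → HasDegree≥3 G v →
                           Σ (InfWord (Fin n)) λ w → Σ (Fin n → Fin 4) λ φ →
                             IsGWord G w × SquareFree (mapWord φ w)
degree≥3⇒squareFreeImage n G v degree≥3 with clawEmbedding G degree≥3
... | e , e-injective , e-hom with injective⇒leftInverse _≟_ e e-injective
... | φ , φ∘e≡id = mapWord e clawWord , φ ,
                   mapWord-isGWord {H = K13} {G = G} e-hom clawWord-isGWord ,
                   squareFree-resp-≗ (λ i → sym (φ∘e≡id (clawWord i))) clawWord-squareFree

lemma8 : ((n : ℕ) (G : SimpleGraph n) (v : Fin n) → HasDegree≥3 G v →
              Σ (InfWord (Fin n)) λ w → Σ (Fin n → Fin 4) λ φ →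
                IsGWord G w × SquareFree (mapWord φ w))
           × ¬ (Σ (InfWord (Fin 4)) λ w → Σ (Fin 4 → Fin 3) λ φ →
                  IsGWord K13 w × SquareFree (mapWord φ w))
lemma8 = degree≥3⇒squareFreeImage , claw-noSquareFreeTernaryImage
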